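{- Let $n\ge1$, let $\phi$ be an $n$-cube unique sink orientation that does not have property L, and let the $2n$-cube unique sink orientation $\psi$ be a kaleidoscope for $\phi$. Then every $2n$-cube unique sink orientation $\psi'$ isomorphic to $\psi$ fails to have property L.
   Context: Notation: $[m]=\{1,\dots,m\}$, $\oplus$ is symmetric difference. An $m$-cube orientation is a directed graph on $2^{[m]}$ containing exactly one of the edges $(V,V\oplus\{i\})$, $(V\oplus\{i\},V)$ for each $V\subseteq[m]$, $i\in[m]$; it is identified with its outmap $\phi(V)=\{i: (V,V\oplus\{i\})\text{ is an edge}\}$. It is a unique sink orientation (USO) if every face (subgraph induced by a set $\{X: A\subseteq X\subseteq B\}$) has exactly one sink. The L-graph of $V$ has vertex set $[m]\setminus V$ and an arc $(i,j)$ for distinct $i,j\in[m]\setminus V$ whenever $j\in\phi(V)\oplus\phi(V\cup\{i\})$; property L means all L-graphs are acyclic. Two $m$-cube USOs $\psi,\psi'$ are isomorphic if there is a bijection $h:2^{[m]}\to2^{[m]}$ such that for all $V,V'$, $(V,V')$ is an edge of $\psi$ iff $(h(V),h(V'))$ is an edge of $\psi'$. For $V\subseteq[2n]$ let $V_L=V\cap[n]$ and $V_H=\{i-n: i\in V\cap\{n+1,\dots,2n\}\}$. A $2n$-cube USO $\psi$ is a kaleidoscope for the $n$-cube USO $\phi$ if $\psi(V)_L=\phi(V_L\oplus V_H)$ for all $V\subseteq[2n]$. -}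

module Defs where

open import Data.Nat using (ℕ; _+_)
open import Data.Bool using (Bool; _xor_)
open import Data.Fin using (Fin)
open import Data.Fin.Subset using (Subset; _∈_; _∉_; _⊆_; _∪_; ⁅_⁆)
open import Data.Vec using (Vec; zipWith; take; drop)
open import Data.Product using (Σ; _×_; ∃)
open import Relation.Binary.PropositionalEquality using (_≡_; _≢_)
open import Relation.Binary.Construct.Closure.Transitive using (TransClosure)
open import Relation.Nullary using (¬_)
open import Function.Definitions using (Bijective)

_⊕_ : ∀ {m} → Subset m → Subset m → Subset m
_⊕_ = zipWith _xor_

infixl 6 _⊕_

-- An outmap on the m-cube: vertex V ↦ set of outgoing directions
Outmap : ℕ → Set
Outmap m = Subset m → Subset m

IsOrientation : ∀ {m} → Outmap m → Set
IsOrientation {m} φ = ∀ (V : Subset m) (i : Fin m) →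
  (i ∈ φ V → i ∉ φ (V ⊕ ⁅ i ⁆)) × (i ∉ φ V → i ∈ φ (V ⊕ ⁅ i ⁆))

Edge : ∀ {m} → Outmap m → Subset m → Subset m → Set
Edge {m} φ V V′ = Σ (Fin m) λ i → (V′ ≡ V ⊕ ⁅ i ⁆) × (i ∈ φ V)

InFace : ∀ {m} → Subset m → Subset m → Subset m → Set
InFace A B X = (A ⊆ X) × (X ⊆ B)

IsSinkOfFace : ∀ {m} → Outmap m → Subset m → Subset m → Subset m → Set
IsSinkOfFace φ A B X = InFace A B X × (∀ Y → InFace A B Y → ¬ Edge φ X Y)

IsUSO : ∀ {m} → Outmap m → Set
IsUSO {m} φ = IsOrientation φ ×
  (∀ (A B : Subset m) → A ⊆ B →
     Σ (Subset m) λ X → IsSinkOfFace φ A B X ×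
       (∀ Y → IsSinkOfFace φ A B Y → Y ≡ X))

LArc : ∀ {m} → Outmap m → Subset m → Fin m → Fin m → Set
LArc φ V i j = (i ∉ V) × (j ∉ V) × (i ≢ j) × (j ∈ (φ V ⊕ φ (V ∪ ⁅ i ⁆)))

Acyclic : ∀ {m} → (Fin m → Fin m → Set) → Set
Acyclic {m} G = ∀ (i : Fin m) → ¬ TransClosure G i i

PropertyL : ∀ {m} → Outmap m → Set
PropertyL {m} φ = ∀ (V : Subset m) → Acyclic (LArc φ V)

Isomorphic : ∀ {m} → Outmap m → Outmap m → Set
Isomorphic {m} ψ ψ′ = Σ (Subset m → Subset m) λ h →
  Bijective _≡_ _≡_ h ×
  (∀ V V′ → (Edge ψ V V′ → Edge ψ′ (h V) (h V′)) × (Edge ψ′ (h V) (h V′) → Edge ψ V V′))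

low : ∀ {n} → Subset (n + n) → Subset n
low {n} V = take n V

high : ∀ {n} → Subset (n + n) → Subset n
high {n} V = drop n V

IsKaleidoscope : ∀ {n} → Outmap n → Outmap (n + n) → Set
IsKaleidoscope {n} φ ψ = IsUSO ψ × (∀ (V : Subset (n + n)) → low (ψ V) ≡ φ (low V ⊕ high V))

-- A graph isomorphism h of the cube is affine: there is a permutation σ of the coordinates with
-- h (V ⊕ {k}) = h V ⊕ {σ k}, hence h V = h ∅ ⊕ σ V, and an isomorphism ψ ≅ ψ′ satisfies
-- σ k ∈ ψ′ (h V) ⇔ k ∈ ψ V. Since the low half of a kaleidoscope ψ at V depends only on
-- V_L ⊕ V_H, for every U one can pick V = L ++ (L ⊕ U) with L chosen so that h V contains
-- none of the directions σ i, i ∈ [n]. Then every arc i → j of the L-graph of φ at U is sent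
-- to the arc σ i → σ j of the L-graph of ψ′ at h V, so a cycle for φ gives a cycle for ψ′.
module Submission where

open import Defs
open import Algebra.Bundles using (AbelianGroup)
open import Algebra.Structures using (IsAbelianGroup)
import Algebra.Properties.Group as GroupProperties
import Algebra.Properties.CommutativeSemigroup as CommutativeSemigroupProperties
open import Data.Bool using (true; false; _xor_)
open import Data.Bool.Properties
  using (xor-assoc; xor-comm; xor-identityˡ; xor-identityʳ; xor-same; ∨-identityʳ; ¬-not; not-¬)
open import Data.Fin using (Fin; zero; suc; _↑ˡ_)
open import Data.Fin.Properties using (_≟_; ↑ˡ-injective)
open import Data.Fin.Subset using (Subset; _∈_; _∉_; _∪_; ⁅_⁆; ⊥)
open import Data.Fin.Subset.Properties using (x∈⁅x⁆; x∈⁅y⁆⇒x≡y; x≢y⇒x∉⁅y⁆; ∪-identityʳ; _∈?_)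
open import Data.Nat using (ℕ; zero; suc; _+_; _≥_)
open import Data.Product using (∃; _×_; _,_; proj₁; proj₂)
open import Data.Vec using ([]; _∷_; _++_; lookup; tabulate; here; there)
open import Data.Vec.Properties
  using (zipWith-assoc; zipWith-comm; zipWith-identityˡ; zipWith-identityʳ; lookup-zipWith;
         []=⇒lookup; lookup⇒[]=; lookup-replicate; lookup∘tabulate; lookup-++ˡ;
         take-zipWith; drop-zipWith; take++drop≡id; ++-injectiveˡ; ++-injectiveʳ)
open import Function using (id; _∘_; _⇔_; mk⇔; Equivalence)
open import Level using (0ℓ)
open import Relation.Binary.Core using (Rel)
open import Relation.Binary.PropositionalEquality
open import Relation.Binary.Construct.Closure.Transitive using (TransClosure; [_]; _∷_)
open import Relation.Nullary using (¬_; yes; no; contradiction)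

⊕-self : ∀ {m} (X : Subset m) → X ⊕ X ≡ ⊥
⊕-self []      = refl
⊕-self (x ∷ X) = cong₂ _∷_ (xor-same x) (⊕-self X)

⊕-isAbelianGroup : ∀ {m} → IsAbelianGroup (_≡_ {A = Subset m}) _⊕_ ⊥ id
⊕-isAbelianGroup = record
  { isGroup = record
    { isMonoid = record
      { isSemigroup = record
        { isMagma = record { isEquivalence = isEquivalence ; ∙-cong = cong₂ _⊕_ }
        ; assoc   = zipWith-assoc xor-assoc
        }
      ; identity = zipWith-identityˡ xor-identityˡ , zipWith-identityʳ xor-identityʳ
      }
    ; inverse = ⊕-self , ⊕-self
    ; ⁻¹-cong = cong id
    }
  ; comm = zipWith-comm xor-comm
  }

⊕-abelianGroup : ℕ → AbelianGroup 0ℓ 0ℓ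
⊕-abelianGroup m = record { isAbelianGroup = ⊕-isAbelianGroup {m} }

module ⊕-Properties {m : ℕ} where
  open AbelianGroup (⊕-abelianGroup m) public
    using () renaming (assoc to ⊕-assoc; comm to ⊕-comm; identityˡ to ⊕-identityˡ; identityʳ to ⊕-identityʳ)
  open GroupProperties (AbelianGroup.group (⊕-abelianGroup m)) public
    using () renaming (∙-cancelˡ to ⊕-cancelˡ; ∙-cancelʳ to ⊕-cancelʳ)
  open CommutativeSemigroupProperties (AbelianGroup.commutativeSemigroup (⊕-abelianGroup m)) public
    using () renaming (interchange to ⊕-interchange; xy∙z≈xz∙y to xy⊕z≡xz⊕y)

open ⊕-Properties

xy⊕y≡x : ∀ {m} (X Y : Subset m) → (X ⊕ Y) ⊕ Y ≡ X
xy⊕y≡x X Y = begin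
  (X ⊕ Y) ⊕ Y ≡⟨ ⊕-assoc X Y Y ⟩
  X ⊕ (Y ⊕ Y) ≡⟨ cong (X ⊕_) (⊕-self Y) ⟩
  X ⊕ ⊥       ≡⟨ ⊕-identityʳ X ⟩
  X           ∎
  where open ≡-Reasoning

lookup-⊕ : ∀ {m} (X Y : Subset m) i → lookup (X ⊕ Y) i ≡ lookup X i xor lookup Y i
lookup-⊕ X Y i = lookup-zipWith _xor_ i X Y

lookup-∉ : ∀ {m} {X : Subset m} {i} → i ∉ X → lookup X i ≡ false
lookup-∉ {X = X} {i} i∉X = ¬-not (i∉X ∘ lookup⇒[]= i X)

lookup≡false⇒∉ : ∀ {m} {X : Subset m} {i} → lookup X i ≡ false → i ∉ X
lookup≡false⇒∉ X[i]≡false i∈X = not-¬ X[i]≡false ([]=⇒lookup i∈X)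

∈⇔⇒lookup≡ : ∀ {m k} {X : Subset m} {Y : Subset k} {i j} → (i ∈ X ⇔ j ∈ Y) → lookup X i ≡ lookup Y j
∈⇔⇒lookup≡ {X = X} {Y} {i} {j} X⇔Y with lookup X i in X[i] | lookup Y j in Y[j]
... | true  | true  = refl
... | false | false = refl
... | true  | false = contradiction ([]=⇒lookup (Equivalence.to X⇔Y (lookup⇒[]= i X X[i])))
                                    (not-¬ Y[j])
... | false | true  = contradiction ([]=⇒lookup (Equivalence.from X⇔Y (lookup⇒[]= j Y Y[j])))
                                    (not-¬ X[i])

lookup-⁅⁆-self : ∀ {m} (a : Fin m) → lookup ⁅ a ⁆ a ≡ true
lookup-⁅⁆-self a = []=⇒lookup (x∈⁅x⁆ a)

lookup-⁅⁆-≢ : ∀ {m} {a b : Fin m} → a ≢ b → lookup ⁅ a ⁆ b ≡ false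
lookup-⁅⁆-≢ a≢b = lookup-∉ (x≢y⇒x∉⁅y⁆ (a≢b ∘ sym))

lookup-⁅⁆-injective : ∀ {m k} {σ : Fin m → Fin k} → (∀ {a b} → σ a ≡ σ b → a ≡ b) →
                      ∀ a b → lookup ⁅ σ a ⁆ (σ b) ≡ lookup ⁅ a ⁆ b
lookup-⁅⁆-injective {σ = σ} σ-injective a b with a ≟ b
... | yes refl = trans (lookup-⁅⁆-self (σ a)) (sym (lookup-⁅⁆-self a))
... | no a≢b   = trans (lookup-⁅⁆-≢ (a≢b ∘ σ-injective)) (sym (lookup-⁅⁆-≢ a≢b))

⁅⁆-injective : ∀ {m} {a b : Fin m} → ⁅ a ⁆ ≡ ⁅ b ⁆ → a ≡ b
⁅⁆-injective {a = a} e = x∈⁅y⁆⇒x≡y _ (subst (a ∈_) e (x∈⁅x⁆ a))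

⊕⁅⁆-injective : ∀ {m} (X : Subset m) {a b} → X ⊕ ⁅ a ⁆ ≡ X ⊕ ⁅ b ⁆ → a ≡ b
⊕⁅⁆-injective X e = ⁅⁆-injective (⊕-cancelˡ X _ _ e)

⁅⁆⊕⁅⁆-square : ∀ {m} {a b x y : Fin m} → a ≢ b → x ≢ a →
               ⁅ a ⁆ ⊕ ⁅ x ⁆ ≡ ⁅ b ⁆ ⊕ ⁅ y ⁆ → x ≡ b
⁅⁆⊕⁅⁆-square {a = a} {b} {x} {y} a≢b x≢a e with x∈⁅y⁆⇒x≡y y (lookup⇒[]= a ⁅ y ⁆ a∈⁅y⁆)
  where
  open ≡-Reasoning
  a∈⁅y⁆ : lookup ⁅ y ⁆ a ≡ true
  a∈⁅y⁆ = begin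
    lookup ⁅ y ⁆ a                    ≡⟨ cong (_xor lookup ⁅ y ⁆ a) (lookup-⁅⁆-≢ (a≢b ∘ sym)) ⟨
    lookup ⁅ b ⁆ a xor lookup ⁅ y ⁆ a ≡⟨ lookup-⊕ ⁅ b ⁆ ⁅ y ⁆ a ⟨
    lookup (⁅ b ⁆ ⊕ ⁅ y ⁆) a          ≡⟨ cong (λ Z → lookup Z a) e ⟨
    lookup (⁅ a ⁆ ⊕ ⁅ x ⁆) a          ≡⟨ lookup-⊕ ⁅ a ⁆ ⁅ x ⁆ a ⟩
    lookup ⁅ a ⁆ a xor lookup ⁅ x ⁆ a ≡⟨ cong₂ _xor_ (lookup-⁅⁆-self a) (lookup-⁅⁆-≢ x≢a) ⟩
    true                              ∎
... | refl = ⁅⁆-injective (⊕-cancelˡ ⁅ a ⁆ ⁅ x ⁆ ⁅ b ⁆ (trans e (⊕-comm ⁅ b ⁆ ⁅ a ⁆)))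

∉⇒∪⁅⁆≡⊕⁅⁆ : ∀ {m} {X : Subset m} {i} → i ∉ X → X ∪ ⁅ i ⁆ ≡ X ⊕ ⁅ i ⁆
∉⇒∪⁅⁆≡⊕⁅⁆ {X = true  ∷ X} {zero}  i∉X = contradiction here i∉X
∉⇒∪⁅⁆≡⊕⁅⁆ {X = false ∷ X} {zero}  _   = cong (true ∷_) (trans (∪-identityʳ X) (sym (⊕-identityʳ X)))
∉⇒∪⁅⁆≡⊕⁅⁆ {X = x     ∷ X} {suc i} i∉X =
  cong₂ _∷_ (trans (∨-identityʳ x) (sym (xor-identityʳ x))) (∉⇒∪⁅⁆≡⊕⁅⁆ (i∉X ∘ there))

⊕⁅⁆-induction : ∀ {m} (P : Subset m → Set) → P ⊥ → (∀ V k → P V → P (V ⊕ ⁅ k ⁆)) → ∀ V → P V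
⊕⁅⁆-induction P P⊥ step []          = P⊥
⊕⁅⁆-induction P P⊥ step (false ∷ V) =
  ⊕⁅⁆-induction (P ∘ (false ∷_)) P⊥ (λ V k → step (false ∷ V) (suc k)) V
⊕⁅⁆-induction P P⊥ step (true ∷ V)  =
  ⊕⁅⁆-induction (P ∘ (true ∷_)) (subst (P ∘ (true ∷_)) (⊕-self ⊥) (step ⊥ zero P⊥))
    (λ V k → step (true ∷ V) (suc k)) V

Adjacent : ∀ {m} → Subset m → Subset m → Set
Adjacent X Y = ∃ λ a → Y ≡ X ⊕ ⁅ a ⁆

adjacent-sym : ∀ {m} {X Y : Subset m} → Adjacent X Y → Adjacent Y X
adjacent-sym {X = X} (a , refl) = a , sym (xy⊕y≡x X ⁅ a ⁆)

module AdjacencyPreserving {m} (h : Subset m → Subset m) (h-injective : ∀ {X Y} → h X ≡ h Y → X ≡ Y)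
                           (h-adjacent : ∀ V k → Adjacent (h V) (h (V ⊕ ⁅ k ⁆))) where

  direction : Fin m → Fin m
  direction k = proj₁ (h-adjacent ⊥ k)

  direction-injective : ∀ {j k} → direction j ≡ direction k → j ≡ k
  direction-injective {j} {k} σj≡σk = ⊕⁅⁆-injective ⊥ (h-injective (begin
    h (⊥ ⊕ ⁅ j ⁆)         ≡⟨ proj₂ (h-adjacent ⊥ j) ⟩
    h ⊥ ⊕ ⁅ direction j ⁆ ≡⟨ cong (λ a → h ⊥ ⊕ ⁅ a ⁆) σj≡σk ⟩
    h ⊥ ⊕ ⁅ direction k ⁆ ≡⟨ proj₂ (h-adjacent ⊥ k) ⟨
    h (⊥ ⊕ ⁅ k ⁆)         ∎))
    where open ≡-Reasoning

  FollowsDirections : Subset m → Set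
  FollowsDirections V = ∀ k → h (V ⊕ ⁅ k ⁆) ≡ h V ⊕ ⁅ direction k ⁆

  -- The k-edges at V and at V ⊕ {j} are opposite sides of a 2-face, and h maps 2-faces to 2-faces.
  opposite-direction : ∀ V {j k} → j ≢ k → FollowsDirections V →
                       h ((V ⊕ ⁅ j ⁆) ⊕ ⁅ k ⁆) ≡ h (V ⊕ ⁅ j ⁆) ⊕ ⁅ direction k ⁆
  opposite-direction V {j} {k} j≢k follows
    with h-adjacent (V ⊕ ⁅ j ⁆) k | h-adjacent (V ⊕ ⁅ k ⁆) j
  ... | x , hVjk≡ | y , hVkj≡ = subst (λ a → h ((V ⊕ ⁅ j ⁆) ⊕ ⁅ k ⁆) ≡ h (V ⊕ ⁅ j ⁆) ⊕ ⁅ a ⁆) x≡σk hVjk≡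
    where
    open ≡-Reasoning
    face : h V ⊕ (⁅ direction j ⁆ ⊕ ⁅ x ⁆) ≡ h V ⊕ (⁅ direction k ⁆ ⊕ ⁅ y ⁆)
    face = begin
      h V ⊕ (⁅ direction j ⁆ ⊕ ⁅ x ⁆) ≡⟨ ⊕-assoc (h V) _ _ ⟨
      (h V ⊕ ⁅ direction j ⁆) ⊕ ⁅ x ⁆ ≡⟨ cong (_⊕ ⁅ x ⁆) (follows j) ⟨
      h (V ⊕ ⁅ j ⁆) ⊕ ⁅ x ⁆           ≡⟨ hVjk≡ ⟨
      h ((V ⊕ ⁅ j ⁆) ⊕ ⁅ k ⁆)         ≡⟨ cong h (xy⊕z≡xz⊕y V ⁅ j ⁆ ⁅ k ⁆) ⟩
      h ((V ⊕ ⁅ k ⁆) ⊕ ⁅ j ⁆)         ≡⟨ hVkj≡ ⟩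
      h (V ⊕ ⁅ k ⁆) ⊕ ⁅ y ⁆           ≡⟨ cong (_⊕ ⁅ y ⁆) (follows k) ⟩
      (h V ⊕ ⁅ direction k ⁆) ⊕ ⁅ y ⁆ ≡⟨ ⊕-assoc (h V) _ _ ⟩
      h V ⊕ (⁅ direction k ⁆ ⊕ ⁅ y ⁆) ∎
    x≢σj : x ≢ direction j
    x≢σj refl = j≢k (⊕⁅⁆-injective V (⊕-cancelʳ ⁅ k ⁆ _ _ (h-injective (begin
      h ((V ⊕ ⁅ j ⁆) ⊕ ⁅ k ⁆)                    ≡⟨ hVjk≡ ⟩
      h (V ⊕ ⁅ j ⁆) ⊕ ⁅ direction j ⁆           ≡⟨ cong (_⊕ ⁅ direction j ⁆) (follows j) ⟩
      (h V ⊕ ⁅ direction j ⁆) ⊕ ⁅ direction j ⁆ ≡⟨ xy⊕y≡x (h V) _ ⟩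
      h V                                        ≡⟨ cong h (xy⊕y≡x V ⁅ k ⁆) ⟨
      h ((V ⊕ ⁅ k ⁆) ⊕ ⁅ k ⁆)                    ∎))))
    x≡σk : x ≡ direction k
    x≡σk = ⁅⁆⊕⁅⁆-square (j≢k ∘ direction-injective) x≢σj (⊕-cancelˡ (h V) _ _ face)

  followsDirections-⊕⁅⁆ : ∀ V j → FollowsDirections V → FollowsDirections (V ⊕ ⁅ j ⁆)
  followsDirections-⊕⁅⁆ V j follows k with j ≟ k
  ... | no j≢k   = opposite-direction V j≢k follows
  ... | yes refl = begin
    h ((V ⊕ ⁅ j ⁆) ⊕ ⁅ j ⁆)                    ≡⟨ cong h (xy⊕y≡x V ⁅ j ⁆) ⟩
    h V                                        ≡⟨ xy⊕y≡x (h V) ⁅ direction j ⁆ ⟨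
    (h V ⊕ ⁅ direction j ⁆) ⊕ ⁅ direction j ⁆ ≡⟨ cong (_⊕ ⁅ direction j ⁆) (follows j) ⟨
    h (V ⊕ ⁅ j ⁆) ⊕ ⁅ direction j ⁆           ∎
    where open ≡-Reasoning

  h-⊕⁅⁆ : ∀ V k → h (V ⊕ ⁅ k ⁆) ≡ h V ⊕ ⁅ direction k ⁆
  h-⊕⁅⁆ = ⊕⁅⁆-induction FollowsDirections (λ k → proj₂ (h-adjacent ⊥ k)) followsDirections-⊕⁅⁆

  h-affine : ∀ V k → lookup (h V) (direction k) ≡ lookup (h ⊥) (direction k) xor lookup V k
  h-affine V k = ⊕⁅⁆-induction P P⊥ step V
    where
    open ≡-Reasoning
    c = lookup (h ⊥) (direction k)
    P : Subset m → Set
    P V = lookup (h V) (direction k) ≡ c xor lookup V k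
    P⊥ : P ⊥
    P⊥ = sym (trans (cong (c xor_) (lookup-replicate k false)) (xor-identityʳ c))
    step : ∀ V j → P V → P (V ⊕ ⁅ j ⁆)
    step V j PV = begin
      lookup (h (V ⊕ ⁅ j ⁆)) (direction k)                      ≡⟨ cong (λ W → lookup W (direction k)) (h-⊕⁅⁆ V j) ⟩
      lookup (h V ⊕ ⁅ direction j ⁆) (direction k)              ≡⟨ lookup-⊕ (h V) _ _ ⟩
      lookup (h V) (direction k) xor lookup ⁅ direction j ⁆ (direction k)
                                                                ≡⟨ cong₂ _xor_ PV (lookup-⁅⁆-injective direction-injective j k) ⟩
      (c xor lookup V k) xor lookup ⁅ j ⁆ k                     ≡⟨ xor-assoc c _ _ ⟩
      c xor (lookup V k xor lookup ⁅ j ⁆ k)                     ≡⟨ cong (c xor_) (lookup-⊕ V ⁅ j ⁆ k) ⟨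
      c xor lookup (V ⊕ ⁅ j ⁆) k                                ∎

edge-⊕⁅⁆⇔∈ : ∀ {m} (φ : Outmap m) V k → Edge φ V (V ⊕ ⁅ k ⁆) ⇔ k ∈ φ V
edge-⊕⁅⁆⇔∈ φ V k = mk⇔ (λ (a , e , a∈φV) → subst (_∈ φ V) (sym (⊕⁅⁆-injective V e)) a∈φV)
                        (λ k∈φV → k , refl , k∈φV)

PreservesEdges : ∀ {m} → Outmap m → Outmap m → (Subset m → Subset m) → Set
PreservesEdges ψ ψ′ h =
  ∀ V V′ → (Edge ψ V V′ → Edge ψ′ (h V) (h V′)) × (Edge ψ′ (h V) (h V′) → Edge ψ V V′)

edge⇒adjacent : ∀ {m} {φ : Outmap m} {V V′} → Edge φ V V′ → Adjacent V V′
edge⇒adjacent (a , V′≡ , _) = a , V′≡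

preservesEdges⇒adjacent : ∀ {m} {ψ ψ′ : Outmap m} {h} → IsOrientation ψ → PreservesEdges ψ ψ′ h →
                          ∀ V k → Adjacent (h V) (h (V ⊕ ⁅ k ⁆))
preservesEdges⇒adjacent {ψ = ψ} {ψ′} ψ-orientation h-edges V k with k ∈? ψ V
... | yes k∈ψV = edge⇒adjacent {φ = ψ′} (proj₁ (h-edges V (V ⊕ ⁅ k ⁆)) (k , refl , k∈ψV))
... | no  k∉ψV = adjacent-sym (edge⇒adjacent {φ = ψ′} (proj₁ (h-edges (V ⊕ ⁅ k ⁆) V)
                   (k , sym (xy⊕y≡x V ⁅ k ⁆) , proj₂ (ψ-orientation V k) k∉ψV)))

module EdgeIsomorphism {m} {ψ ψ′ : Outmap m} (ψ-orientation : IsOrientation ψ)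
                       (h : Subset m → Subset m) (h-injective : ∀ {X Y} → h X ≡ h Y → X ≡ Y)
                       (h-edges : PreservesEdges ψ ψ′ h) where

  open AdjacencyPreserving h h-injective (preservesEdges⇒adjacent {ψ′ = ψ′} ψ-orientation h-edges) public

  ∈-transport : ∀ V k → k ∈ ψ V ⇔ direction k ∈ ψ′ (h V)
  ∈-transport V k = mk⇔
    (λ k∈ψV → Equivalence.to (edge-⊕⁅⁆⇔∈ ψ′ (h V) (direction k))
      (subst (Edge ψ′ (h V)) (h-⊕⁅⁆ V k) (proj₁ (h-edges V (V ⊕ ⁅ k ⁆)) (k , refl , k∈ψV))))
    (λ σk∈ψ′hV → Equivalence.to (edge-⊕⁅⁆⇔∈ ψ V k)
      (proj₂ (h-edges V (V ⊕ ⁅ k ⁆))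
        (subst (Edge ψ′ (h V)) (sym (h-⊕⁅⁆ V k)) (direction k , refl , σk∈ψ′hV))))

  lookup-⊕-transport : ∀ V W k → lookup (ψ′ (h V) ⊕ ψ′ (h W)) (direction k) ≡ lookup (ψ V ⊕ ψ W) k
  lookup-⊕-transport V W k = begin
    lookup (ψ′ (h V) ⊕ ψ′ (h W)) (direction k)                        ≡⟨ lookup-⊕ (ψ′ (h V)) _ _ ⟩
    lookup (ψ′ (h V)) (direction k) xor lookup (ψ′ (h W)) (direction k)
                                   ≡⟨ cong₂ _xor_ (∈⇔⇒lookup≡ (∈-transport V k)) (∈⇔⇒lookup≡ (∈-transport W k)) ⟨
    lookup (ψ V) k xor lookup (ψ W) k                                  ≡⟨ lookup-⊕ (ψ V) _ _ ⟨
    lookup (ψ V ⊕ ψ W) k                                               ∎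
    where open ≡-Reasoning

fold : ∀ {n} → Subset (n + n) → Subset n
fold V = low V ⊕ high V

low-++ : ∀ {n} (L M : Subset n) → low (L ++ M) ≡ L
low-++ {n} L M = ++-injectiveˡ (low (L ++ M)) L (take++drop≡id n (L ++ M))

high-++ : ∀ {n} (L M : Subset n) → high (L ++ M) ≡ M
high-++ {n} L M = ++-injectiveʳ (low (L ++ M)) L (take++drop≡id n (L ++ M))

lookup-low : ∀ {n} (V : Subset (n + n)) i → lookup (low V) i ≡ lookup V (i ↑ˡ n)
lookup-low {n} V i = trans (sym (lookup-++ˡ (low V) (high V) i)) (cong (λ W → lookup W (i ↑ˡ n)) (take++drop≡id n V))

fold-⊕ : ∀ {n} (V W : Subset (n + n)) → fold {n} (V ⊕ W) ≡ fold V ⊕ fold W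
fold-⊕ {n} V W = trans (cong₂ _⊕_ (take-zipWith {m = n} _xor_ V W) (drop-zipWith {m = n} _xor_ V W))
                        (⊕-interchange (low V) (low W) (high V) (high W))

⊥++⊥ : ∀ m {n} → ⊥ {m} ++ ⊥ {n} ≡ ⊥
⊥++⊥ zero    = refl
⊥++⊥ (suc m) = cong (false ∷_) (⊥++⊥ m)

⁅↑ˡ⁆≡⁅⁆++⊥ : ∀ {m} n (i : Fin m) → ⁅ i ↑ˡ n ⁆ ≡ ⁅ i ⁆ ++ ⊥ {n}
⁅↑ˡ⁆≡⁅⁆++⊥ {suc m} n zero    = cong (true ∷_) (sym (⊥++⊥ m))
⁅↑ˡ⁆≡⁅⁆++⊥         n (suc i) = cong (false ∷_) (⁅↑ˡ⁆≡⁅⁆++⊥ n i)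

fold-⁅↑ˡ⁆ : ∀ {n} (i : Fin n) → fold ⁅ i ↑ˡ n ⁆ ≡ ⁅ i ⁆
fold-⁅↑ˡ⁆ {n} i = begin
  fold ⁅ i ↑ˡ n ⁆        ≡⟨ cong fold (⁅↑ˡ⁆≡⁅⁆++⊥ n i) ⟩
  fold (⁅ i ⁆ ++ ⊥)      ≡⟨ cong₂ _⊕_ (low-++ ⁅ i ⁆ ⊥) (high-++ ⁅ i ⁆ ⊥) ⟩
  ⁅ i ⁆ ⊕ ⊥              ≡⟨ ⊕-identityʳ ⁅ i ⁆ ⟩
  ⁅ i ⁆                  ∎
  where open ≡-Reasoning

fold-diagonal : ∀ {n} (L U : Subset n) → fold (L ++ (L ⊕ U)) ≡ U
fold-diagonal L U = begin
  fold (L ++ (L ⊕ U)) ≡⟨ cong₂ _⊕_ (low-++ L (L ⊕ U)) (high-++ L (L ⊕ U)) ⟩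
  L ⊕ (L ⊕ U)         ≡⟨ ⊕-assoc L L U ⟨
  (L ⊕ L) ⊕ U         ≡⟨ cong (_⊕ U) (⊕-self L) ⟩
  ⊥ ⊕ U               ≡⟨ ⊕-identityˡ U ⟩
  U                   ∎
  where open ≡-Reasoning

kaleidoscope-low-⊕ : ∀ {n} {φ : Outmap n} {ψ : Outmap (n + n)} → (∀ V → low (ψ V) ≡ φ (fold V)) →
                     ∀ V i → low (ψ V ⊕ ψ (V ⊕ ⁅ i ↑ˡ n ⁆)) ≡ φ (fold V) ⊕ φ (fold V ⊕ ⁅ i ⁆)
kaleidoscope-low-⊕ {n} {φ} {ψ} kaleidoscope V i = begin
  low (ψ V ⊕ ψ (V ⊕ ⁅ i ↑ˡ n ⁆))             ≡⟨ take-zipWith {m = n} _xor_ (ψ V) _ ⟩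
  low (ψ V) ⊕ low (ψ (V ⊕ ⁅ i ↑ˡ n ⁆))       ≡⟨ cong₂ _⊕_ (kaleidoscope V) (kaleidoscope _) ⟩
  φ (fold V) ⊕ φ (fold (V ⊕ ⁅ i ↑ˡ n ⁆))     ≡⟨ cong (λ X → φ (fold V) ⊕ φ X) (fold-⊕ V _) ⟩
  φ (fold V) ⊕ φ (fold V ⊕ fold ⁅ i ↑ˡ n ⁆)  ≡⟨ cong (λ X → φ (fold V) ⊕ φ (fold V ⊕ X)) (fold-⁅↑ˡ⁆ i) ⟩
  φ (fold V) ⊕ φ (fold V ⊕ ⁅ i ⁆)            ∎
  where open ≡-Reasoning

TransClosure-map : ∀ {a b ℓ₁ ℓ₂} {A : Set a} {B : Set b} {R : Rel A ℓ₁} {S : Rel B ℓ₂} (f : A → B) →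
                   (∀ {x y} → R x y → S (f x) (f y)) → ∀ {x y} → TransClosure R x y → TransClosure S (f x) (f y)
TransClosure-map f R⇒S [ xRy ]       = [ R⇒S xRy ]
TransClosure-map f R⇒S (xRy ∷ yR⁺z) = R⇒S xRy ∷ TransClosure-map f R⇒S yR⁺z

acyclic-preimage : ∀ {m k} {G : Fin m → Fin m → Set} {H : Fin k → Fin k → Set} (f : Fin m → Fin k) →
                   (∀ {i j} → G i j → H (f i) (f j)) → Acyclic H → Acyclic G
acyclic-preimage f G⇒H H-acyclic i cycle = H-acyclic (f i) (TransClosure-map f G⇒H cycle)

module KaleidoscopeIsomorphism {n} {φ : Outmap n} {ψ ψ′ : Outmap (n + n)} (ψ-orientation : IsOrientation ψ)
                               (kaleidoscope : ∀ V → low (ψ V) ≡ φ (fold V))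
                               (h : Subset (n + n) → Subset (n + n)) (h-injective : ∀ {X Y} → h X ≡ h Y → X ≡ Y)
                               (h-edges : PreservesEdges ψ ψ′ h) where

  open EdgeIsomorphism {ψ′ = ψ′} ψ-orientation h h-injective h-edges

  embed : Fin n → Fin (n + n)
  embed i = direction (i ↑ˡ n)

  -- Shifting both halves by base leaves fold unchanged and clears the bits of h ⊥ along embed.
  base : Subset n
  base = tabulate (λ c → lookup (h ⊥) (embed c))

  lift : Subset n → Subset (n + n)
  lift U = base ++ (base ⊕ U)

  embed-∉ : ∀ U c → embed c ∉ h (lift U)
  embed-∉ U c = lookup≡false⇒∉ (begin
    lookup (h (lift U)) (embed c)                        ≡⟨ h-affine (lift U) (c ↑ˡ n) ⟩
    lookup (h ⊥) (embed c) xor lookup (lift U) (c ↑ˡ n) ≡⟨ cong (lookup (h ⊥) (embed c) xor_) lift[c] ⟩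
    lookup (h ⊥) (embed c) xor lookup (h ⊥) (embed c)   ≡⟨ xor-same (lookup (h ⊥) (embed c)) ⟩
    false                                                ∎)
    where
    open ≡-Reasoning
    lift[c] : lookup (lift U) (c ↑ˡ n) ≡ lookup (h ⊥) (embed c)
    lift[c] = trans (lookup-++ˡ base (base ⊕ U) c) (lookup∘tabulate _ c)

  LArc-transport : ∀ U {i j} → LArc φ U i j → LArc ψ′ (h (lift U)) (embed i) (embed j)
  LArc-transport U {i} {j} (i∉U , j∉U , i≢j , j∈) =
    embed-∉ U i , embed-∉ U j , i≢j ∘ ↑ˡ-injective n i j ∘ direction-injective , lookup⇒[]= _ _ (begin
      lookup (ψ′ (h V) ⊕ ψ′ (h V ∪ ⁅ embed i ⁆)) (embed j)
        ≡⟨ cong (λ W → lookup (ψ′ (h V) ⊕ ψ′ W) (embed j))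
                (trans (∉⇒∪⁅⁆≡⊕⁅⁆ (embed-∉ U i)) (sym (h-⊕⁅⁆ V (i ↑ˡ n)))) ⟩
      lookup (ψ′ (h V) ⊕ ψ′ (h (V ⊕ ⁅ i ↑ˡ n ⁆))) (embed j) ≡⟨ lookup-⊕-transport V _ (j ↑ˡ n) ⟩
      lookup (ψ V ⊕ ψ (V ⊕ ⁅ i ↑ˡ n ⁆)) (j ↑ˡ n)           ≡⟨ lookup-low _ j ⟨
      lookup (low (ψ V ⊕ ψ (V ⊕ ⁅ i ↑ˡ n ⁆))) j            ≡⟨ cong (λ X → lookup X j) (kaleidoscope-low-⊕ {φ = φ} kaleidoscope V i) ⟩
      lookup (φ (fold V) ⊕ φ (fold V ⊕ ⁅ i ⁆)) j           ≡⟨ cong (λ X → lookup (φ X ⊕ φ (X ⊕ ⁅ i ⁆)) j) (fold-diagonal base U) ⟩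
      lookup (φ U ⊕ φ (U ⊕ ⁅ i ⁆)) j                       ≡⟨ cong (λ X → lookup (φ U ⊕ φ X) j) (∉⇒∪⁅⁆≡⊕⁅⁆ i∉U) ⟨
      lookup (φ U ⊕ φ (U ∪ ⁅ i ⁆)) j                       ≡⟨ []=⇒lookup j∈ ⟩
      true                                                  ∎)
    where
    open ≡-Reasoning
    V = lift U

theorem4 : ∀ (n : ℕ) → n ≥ 1 →
    (φ : Outmap n) → IsUSO φ → ¬ PropertyL φ →
    (ψ : Outmap (n + n)) → IsUSO ψ → IsKaleidoscope φ ψ →
    (ψ′ : Outmap (n + n)) → IsUSO ψ′ → Isomorphic ψ ψ′ → ¬ PropertyL ψ′
theorem4 n _ φ _ φ-not-L ψ (ψ-orientation , _) (_ , kaleidoscope) ψ′ _ (h , (h-injective , _) , h-edges) ψ′-L =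
  φ-not-L λ U → acyclic-preimage embed (LArc-transport U) (ψ′-L (h (lift U)))
  where open KaleidoscopeIsomorphism {φ = φ} {ψ′ = ψ′} ψ-orientation kaleidoscope h h-injective h-edges
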